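{- Let $n\ge 1$ and let $\sigma\in\mathcal{S}_n$ have order $n$. Let $\xi\in\mathcal{S}_n$ and let $K_\xi=\{\beta\in\mathcal{S}_n : \exists k,l\in\mathbb{N},\ \sigma^k\xi=\beta\sigma^l\}$ be its $\sigma$-equivalence class. Then at least one of the following holds: (i) $|K_\xi|=n^2$; (ii) there exist integers $k,l$ with $\sigma^k\xi=\xi\sigma^l$ such that $1\le k\le l<n$, $k\mid n$, $|K_\xi|=kn$, $k\mid l$, and there exists an integer $s$ with $1\le s<n$, $\gcd(s,n)=1$ and $l=s\odot k$.
   Context: $\mathbb{N}$ is the set of nonnegative integers. $\mathcal{S}_n$ is the symmetric group on $[n]=\{1,\dots,n\}$, with products composed left to right: $(\alpha\beta)(i)=\beta(\alpha(i))$. For $x,y\in[n]$, $x\odot y$ denotes the element of $[n]$ congruent to $xy$ modulo $n$ (so $n$ plays the role of $0$). Elements $\alpha,\beta\in\mathcal{S}_n$ are $\sigma$-equivalent if $\sigma^k\alpha=\beta\sigma^l$ for some $k,l\in\mathbb{N}$; this is an equivalence relation. -}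

module Defs where

open import Data.Nat using (ℕ; zero; suc; _*_; _%_; _≤_; _<_)
open import Data.Fin using (Fin)
open import Data.Fin.Permutation using (Permutation′; _⟨$⟩ʳ_; _∘ₚ_; id)
open import Data.Product using (Σ; ∃; ∃-syntax; _×_; proj₁)
open import Relation.Binary.PropositionalEquality using (_≡_)
open import Relation.Nullary using (¬_)

-- The symmetric group S_n, realised on Fin n (labels 0..n-1 instead of 1..n).
-- Products compose left to right: (α ∘ₚ β) ⟨$⟩ʳ i = β ⟨$⟩ʳ (α ⟨$⟩ʳ i).

_≈ₚ_ : ∀ {n} → Permutation′ n → Permutation′ n → Set
_≈ₚ_ {n} α β = (i : Fin n) → α ⟨$⟩ʳ i ≡ β ⟨$⟩ʳ i

_^ₚ_ : ∀ {n} → Permutation′ n → ℕ → Permutation′ n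
σ ^ₚ zero = id
σ ^ₚ suc k = (σ ^ₚ k) ∘ₚ σ

HasOrder : ∀ {n} → Permutation′ n → ℕ → Set
HasOrder σ m = (1 ≤ m) × (σ ^ₚ m) ≈ₚ id
  × ((j : ℕ) → 1 ≤ j → j < m → ¬ ((σ ^ₚ j) ≈ₚ id))

InClass : ∀ {n} → Permutation′ n → Permutation′ n → Permutation′ n → Set
InClass σ ξ β = ∃[ k ] ∃[ l ] (((σ ^ₚ k) ∘ₚ ξ) ≈ₚ (β ∘ₚ (σ ^ₚ l)))

HasCard : ∀ {n} → (Permutation′ n → Set) → ℕ → Set
HasCard {n} P m =
  Σ (Fin m → Σ (Permutation′ n) P) λ f →
    ((a b : Fin m) → proj₁ (f a) ≈ₚ proj₁ (f b) → a ≡ b)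
    × ((β : Permutation′ n) → P β → ∃[ a ] (proj₁ (f a) ≈ₚ β))

-- x ⊙ y in [n]: the element of {1,…,n} congruent to x*y mod n (n plays the role of 0).
odot : ℕ → ℕ → ℕ → ℕ
odot zero x y = zero
odot (suc m) x y with (x * y) % suc m
... | zero = suc m
... | suc r = suc r

-- The powers of σ form a cyclic group C of order n, and K_ξ is the double coset C ξ C.
-- Call k a shift if σ^k ξ = ξ σ^l for some l, and let d be the least positive shift,
-- with σ^d ξ = ξ σ^l.  Every shift is a multiple of d (so d ∣ n), and the elements
-- σ^a ξ σ^c with a < d and c < n enumerate K_ξ without repetition, so |K_ξ| = d n.
-- As ξ conjugates σ^(j d) to σ^(j l), σ^(j d) = 1 exactly when σ^(j l) = 1; for d < n
-- this makes l/d a unit modulo n/d, and such a unit lifts to a unit s modulo n with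
-- l ≡ s d (mod n).

module Submission where

open import Defs
open import Data.Nat
open import Data.Nat.Properties
open import Data.Nat.DivMod
open import Data.Nat.Divisibility
open import Data.Nat.GCD using (gcd; gcd[m,n]∣m; gcd[m,n]∣n; gcd[m,n]≢0)
open import Data.Nat.Coprimality using (Coprime; coprime-divisor; gcd≡1⇒coprime; coprime⇒gcd≡1)
open import Data.Nat.Induction using (<-rec)
open import Data.Fin using (Fin; toℕ; fromℕ<; combine; remQuot) renaming (_≟_ to _≟ᶠ_)
open import Data.Fin.Properties using (toℕ<n; toℕ-injective; toℕ-fromℕ<; combine-remQuot; remQuot-combine; any?; all?)
open import Data.Fin.Permutation using (Permutation′; _⟨$⟩ʳ_; _⟨$⟩ˡ_; _∘ₚ_; id; inverseˡ; inverseʳ)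
open import Data.Product using (Σ; _×_; _,_; proj₁; proj₂; ∃-syntax; uncurry)
open import Data.Sum using (_⊎_; inj₁; inj₂; [_,_]′)
open import Function using (_∘_; it)
open import Relation.Binary.PropositionalEquality
open import Relation.Nullary using (¬_; Dec; yes; no; contradiction; _×-dec_)
open import Relation.Nullary.Decidable using (map′)

-- Coprimality

coprime-* : ∀ {a b c} → Coprime a b → Coprime a c → Coprime a (b * c)
coprime-* a⊥b a⊥c (g∣a , g∣bc) =
  a⊥c (g∣a , coprime-divisor (λ (h∣g , h∣b) → a⊥b (∣-trans h∣g g∣a , h∣b)) g∣bc)

coprime-^ : ∀ {a t} k → Coprime a t → Coprime a (t ^ k)
coprime-^ zero    _   (_ , g∣1) = ∣1⇒≡1 g∣1
coprime-^ (suc k) a⊥t = coprime-* a⊥t (coprime-^ k a⊥t)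

coprime-∣ʳ : ∀ {a b c} → Coprime a b → c ∣ b → Coprime a c
coprime-∣ʳ a⊥b c∣b (g∣a , g∣c) = a⊥b (g∣a , ∣-trans g∣c c∣b)

coprime-%ˡ : ∀ {a n} .{{_ : NonZero n}} → Coprime a n → Coprime (a % n) n
coprime-%ˡ a⊥n (g∣a%n , g∣n) = a⊥n (∣n∣m%n⇒∣m g∣n g∣a%n , g∣n)

-- Repeatedly dividing N by gcd N t strips off the prime factors it shares with t.
coprime-split : ∀ t N .{{_ : NonZero N}} → ∃[ u ] ∃[ k ] (Coprime u t × N ∣ u * t ^ k)
coprime-split t = <-rec Split split
  where
  Split : ℕ → Set
  Split N = .{{_ : NonZero N}} → ∃[ u ] ∃[ k ] (Coprime u t × N ∣ u * t ^ k)

  split : ∀ N → (∀ {M} → M < N → Split M) → Split N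
  split N rec with gcd N t ≟ 1
  ... | yes g≡1 = N , 0 , gcd≡1⇒coprime g≡1 , ∣-reflexive (sym (*-identityʳ N))
  ... | no  g≢1 with gcd[m,n]∣m N t
  ...   | g∣N@(divides N′ N≡N′g) with rec N′<N {{N′≢0}}
    where
    instance
      g-nonTrivial : NonTrivial (gcd N t)
      g-nonTrivial = n>1⇒nonTrivial
        (≤∧≢⇒< (n≢0⇒n>0 (gcd[m,n]≢0 N t (inj₁ (≢-nonZero⁻¹ N)))) (g≢1 ∘ sym))
    N′≢0 : NonZero N′
    N′≢0 = quotient≢0 g∣N
    N′<N : N′ < N
    N′<N = quotient-< g∣N
  ...     | u , k , u⊥t , N′∣ = u , suc k , u⊥t , N∣
    where
    N∣ : N ∣ u * t ^ suc k
    N∣ = subst₂ _∣_ (sym N≡N′g) (trans (*-assoc u (t ^ k) t) (cong (u *_) (*-comm (t ^ k) t)))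
                (*-pres-∣ N′∣ (gcd[m,n]∣n N t))

coprime-lift : ∀ {t m} n .{{_ : NonZero n}} → Coprime t m → ∃[ u ] Coprime (t + m * u) n
coprime-lift {t} {m} n t⊥m with coprime-split t n
... | u , k , u⊥t , n∣ = u , coprime-∣ʳ (coprime-* s⊥u (coprime-^ k s⊥t)) n∣
  where
  s⊥u : Coprime (t + m * u) u
  s⊥u {g} (g∣s , g∣u) = u⊥t (g∣u , ∣m+n∣m⇒∣n (subst (g ∣_) (+-comm t (m * u)) g∣s) (∣n⇒∣m*n m g∣u))

  s⊥t : Coprime (t + m * u) t
  s⊥t (g∣s , g∣t) = u⊥t (coprime-divisor g⊥m (∣m+n∣m⇒∣n g∣s g∣t) , g∣t)
    where
    g⊥m : Coprime _ m
    g⊥m (h∣g , h∣m) = t⊥m (∣-trans h∣g g∣t , h∣m)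

cancellative⇒coprime : ∀ {t m} .{{_ : NonZero m}} → (∀ j → m ∣ j * t → m ∣ j) → Coprime t m
cancellative⇒coprime {t} {m} cancel {g} (divides t′ t≡t′g , divides m′ m≡m′g) =
  ∣1⇒≡1 (*-cancelˡ-∣ m′ {{m′≢0}} (subst₂ _∣_ m≡m′g (sym (*-identityʳ m′)) m∣m′))
  where
  m′≢0 : NonZero m′
  m′≢0 = m*n≢0⇒m≢0 m′ {{subst NonZero m≡m′g it}}

  m′t≡t′m : m′ * t ≡ t′ * m
  m′t≡t′m = begin
    m′ * t        ≡⟨ cong (m′ *_) t≡t′g ⟩
    m′ * (t′ * g) ≡⟨ *-assoc m′ t′ g ⟨
    m′ * t′ * g   ≡⟨ cong (_* g) (*-comm m′ t′) ⟩
    t′ * m′ * g   ≡⟨ *-assoc t′ m′ g ⟩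
    t′ * (m′ * g) ≡⟨ cong (t′ *_) m≡m′g ⟨
    t′ * m        ∎
    where open ≡-Reasoning

  m∣m′ : m ∣ m′
  m∣m′ = cancel m′ (subst (m ∣_) (sym m′t≡t′m) (n∣m*n t′))

odot≡% : ∀ n x y .{{_ : NonZero n}} → (x * y) % n ≢ 0 → odot n x y ≡ (x * y) % n
odot≡% (suc n) x y r≢0 with (x * y) % suc n
... | zero  = contradiction refl r≢0
... | suc r = refl

[m%n*o]%n≡[m*o]%n : ∀ m o n .{{_ : NonZero n}} → (m % n * o) % n ≡ (m * o) % n
[m%n*o]%n≡[m*o]%n m o n = begin
  (m % n * o) % n             ≡⟨ %-distribˡ-* (m % n) o n ⟩
  (m % n % n * (o % n)) % n   ≡⟨ cong (λ x → (x * (o % n)) % n) (m%n%n≡m%n m n) ⟩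
  (m % n * (o % n)) % n       ≡⟨ %-distribˡ-* m o n ⟨
  (m * o) % n                 ∎
  where open ≡-Reasoning

module SameAnnihilator {n d l} .{{_ : NonZero n}} (d∣n : d ∣ n) (d>0 : 0 < d) (d<n : d < n)
                       (l<n : l < n) (ann⊆ : ∀ j → n ∣ j * d → n ∣ j * l)
                       (ann⊇ : ∀ j → n ∣ j * l → n ∣ j * d) where
  instance
    d≢0 : NonZero d
    d≢0 = >-nonZero d>0
    m≢0 : NonZero (quotient d∣n)
    m≢0 = quotient≢0 d∣n

  m : ℕ
  m = quotient d∣n

  n≡m*d : n ≡ m * d
  n≡m*d = m∣n⇒n≡quotient*m d∣n

  d∣l : d ∣ l
  d∣l = *-cancelˡ-∣ m (subst (_∣ m * l) n≡m*d (ann⊆ m (∣-reflexive n≡m*d)))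

  l≢0 : l ≢ 0
  l≢0 refl = >⇒∤ d<n (subst (n ∣_) (*-identityˡ d) (ann⊇ 1 (n ∣0)))

  d≤l : d ≤ l
  d≤l = ∣⇒≤ {{≢-nonZero l≢0}} d∣l

  t : ℕ
  t = quotient d∣l

  l≡t*d : l ≡ t * d
  l≡t*d = m∣n⇒n≡quotient*m d∣l

  t⊥m : Coprime t m
  t⊥m = cancellative⇒coprime λ j m∣jt →
    *-cancelʳ-∣ d (subst (_∣ j * d) n≡m*d (ann⊇ j (subst₂ _∣_ (sym n≡m*d) (jtd≡jl {j}) (*-monoˡ-∣ d m∣jt))))
    where
    jtd≡jl : ∀ {j} → j * t * d ≡ j * l
    jtd≡jl {j} = trans (*-assoc j t d) (cong (j *_) (sym l≡t*d))

  unit-multiple : ∃[ s ] (1 ≤ s × s < n × gcd s n ≡ 1 × l ≡ odot n s d)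
  unit-multiple with coprime-lift n t⊥m
  ... | u , s₀⊥n = s , s>0 , m%n<n s₀ n , coprime⇒gcd≡1 s⊥n , sym l≡s⊙d
    where
    s₀ = t + m * u
    s  = s₀ % n

    s⊥n : Coprime s n
    s⊥n = coprime-%ˡ s₀⊥n

    s>0 : 0 < s
    s>0 = n≢0⇒n>0 λ s≡0 → <⇒≢ (≤-<-trans d>0 d<n) (sym (s⊥n (subst (n ∣_) (sym s≡0) (n ∣0) , ∣-refl)))

    s₀d≡l+un : s₀ * d ≡ l + u * n
    s₀d≡l+un = begin
      (t + m * u) * d     ≡⟨ *-distribʳ-+ d t (m * u) ⟩
      t * d + m * u * d   ≡⟨ cong₂ _+_ (sym l≡t*d) (trans (cong (_* d) (*-comm m u)) (*-assoc u m d)) ⟩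
      l + u * (m * d)     ≡⟨ cong (λ x → l + u * x) n≡m*d ⟨
      l + u * n           ∎
      where open ≡-Reasoning

    sd%n≡l : (s * d) % n ≡ l
    sd%n≡l = begin
      (s₀ % n * d) % n  ≡⟨ [m%n*o]%n≡[m*o]%n s₀ d n ⟩
      (s₀ * d) % n      ≡⟨ cong (_% n) s₀d≡l+un ⟩
      (l + u * n) % n   ≡⟨ [m+kn]%n≡m%n l u n ⟩
      l % n             ≡⟨ m<n⇒m%n≡m l<n ⟩
      l                 ∎
      where open ≡-Reasoning

    l≡s⊙d : odot n s d ≡ l
    l≡s⊙d = trans (odot≡% n s d (subst (_≢ 0) (sym sd%n≡l) l≢0)) sd%n≡l

least-witness : ∀ {P : ℕ → Set} → (∀ k → Dec (P k)) → ∀ {m} → P m →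
                ∃[ d ] (P d × (∀ {j} → j < d → ¬ P j))
least-witness {P} P? = search _ ≤-refl
  where
  search : ∀ b {m} → m ≤ b → P m → ∃[ d ] (P d × (∀ {j} → j < d → ¬ P j))
  search zero    z≤n p = 0 , p , λ ()
  search (suc b) {m} m≤b p with anyUpTo? P? m
  ... | no  none            = m , p , λ j<m pj → none (_ , j<m , pj)
  ... | yes (j , j<m , pj) = search b (s≤s⁻¹ (≤-trans j<m m≤b)) pj

hasCard-× : ∀ {n a b} {P : Permutation′ n → Set} (F : Fin a × Fin b → Σ (Permutation′ n) P) →
            (∀ p q → proj₁ (F p) ≈ₚ proj₁ (F q) → p ≡ q) →
            (∀ β → P β → ∃[ p ] (proj₁ (F p) ≈ₚ β)) → HasCard P (a * b)
hasCard-× {a = a} {b = b} F F-injective F-surjective = F ∘ remQuot b , injective , surjective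
  where
  injective : ∀ x y → proj₁ (F (remQuot b x)) ≈ₚ proj₁ (F (remQuot b y)) → x ≡ y
  injective x y eq = begin
    x                                  ≡⟨ combine-remQuot {a} b x ⟨
    uncurry combine (remQuot {a} b x)  ≡⟨ cong (uncurry combine) (F-injective _ _ eq) ⟩
    uncurry combine (remQuot {a} b y)  ≡⟨ combine-remQuot {a} b y ⟩
    y                                  ∎
    where open ≡-Reasoning

  surjective : ∀ β → _ → ∃[ x ] (proj₁ (F (remQuot b x)) ≈ₚ β)
  surjective β Pβ with F-surjective β Pβ
  ... | (i , j) , eq = combine i j , subst (λ p → proj₁ (F p) ≈ₚ β) (sym (remQuot-combine i j)) eq

-- Powers of a permutation

module Powers {n : ℕ} (σ : Permutation′ n) where

  infixr 9 _·_
  _·_ : ℕ → Fin n → Fin n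
  a · i = (σ ^ₚ a) ⟨$⟩ʳ i

  ·-+ : ∀ a b i → (a + b) · i ≡ b · a · i
  ·-+ a zero    i = cong (_· i) (+-identityʳ a)
  ·-+ a (suc b) i = trans (cong (_· i) (+-suc a b)) (cong (σ ⟨$⟩ʳ_) (·-+ a b i))

  ·-comm : ∀ a b i → a · b · i ≡ b · a · i
  ·-comm a b i = trans (sym (·-+ b a i)) (trans (cong (_· i) (+-comm b a)) (·-+ a b i))

module Periodic {n} .{{_ : NonZero n}} (σ : Permutation′ n) (σⁿ≈id : (σ ^ₚ n) ≈ₚ id) where
  open Powers σ

  ∣⇒·-id : ∀ {k} → n ∣ k → ∀ i → k · i ≡ i
  ∣⇒·-id (divides zero    refl) i = refl
  ∣⇒·-id (divides (suc q) refl) i =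
    trans (·-+ n (q * n) i) (trans (∣⇒·-id (divides q refl) (n · i)) (σⁿ≈id i))

  ·-% : ∀ a i → a · i ≡ (a % n) · i
  ·-% a i = begin
    a · i                          ≡⟨ cong (_· i) (m≡m%n+[m/n]*n a n) ⟩
    (a % n + a / n * n) · i        ≡⟨ ·-+ (a % n) (a / n * n) i ⟩
    (a / n * n) · (a % n) · i      ≡⟨ ∣⇒·-id (n∣m*n (a / n)) _ ⟩
    (a % n) · i                    ∎
    where open ≡-Reasoning

  negate : ℕ → ℕ
  negate a = n ∸ a % n

  ·-negateˡ : ∀ a i → negate a · a · i ≡ i
  ·-negateˡ a i = begin
    negate a · a · i               ≡⟨ cong (negate a ·_) (·-% a i) ⟩
    negate a · (a % n) · i         ≡⟨ ·-+ (a % n) (negate a) i ⟨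
    (a % n + negate a) · i         ≡⟨ cong (_· i) (m+[n∸m]≡n (<⇒≤ (m%n<n a n))) ⟩
    n · i                          ≡⟨ σⁿ≈id i ⟩
    i                              ∎
    where open ≡-Reasoning

  ·-negateʳ : ∀ a i → a · negate a · i ≡ i
  ·-negateʳ a i = trans (·-comm a (negate a) i) (·-negateˡ a i)

module Order {n} .{{_ : NonZero n}} (σ : Permutation′ n) (order : HasOrder σ n) where
  open Powers σ
  open Periodic σ (proj₁ (proj₂ order))

  ·-id⇒0 : ∀ {r} → r < n → (∀ i → r · i ≡ i) → r ≡ 0
  ·-id⇒0 {zero}  _   _   = refl
  ·-id⇒0 {suc r} r<n fix = contradiction fix (proj₂ (proj₂ order) (suc r) z<s r<n)

  ·-id⇒∣ : ∀ {j} → (∀ i → j · i ≡ i) → n ∣ j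
  ·-id⇒∣ {j} fix = m%n≡0⇒n∣m j n (·-id⇒0 (m%n<n j n) (λ i → trans (sym (·-% j i)) (fix i)))

  ≤-·-injective : ∀ {c c′} → c ≤ c′ → c′ < n → (∀ y → c · y ≡ c′ · y) → c ≡ c′
  ≤-·-injective {c} {c′} c≤c′ c′<n eq =
    ≤-antisym c≤c′ (m∸n≡0⇒m≤n (·-id⇒0 (≤-<-trans (m∸n≤m c′ c) c′<n) fix))
    where
    fix : ∀ z → (c′ ∸ c) · z ≡ z
    fix z = begin
      (c′ ∸ c) · z                     ≡⟨ cong ((c′ ∸ c) ·_) (·-negateʳ c z) ⟨
      (c′ ∸ c) · c · negate c · z      ≡⟨ ·-+ c (c′ ∸ c) _ ⟨
      (c + (c′ ∸ c)) · negate c · z    ≡⟨ cong (_· negate c · z) (m+[n∸m]≡n c≤c′) ⟩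
      c′ · negate c · z                ≡⟨ eq _ ⟨
      c · negate c · z                 ≡⟨ ·-negateʳ c z ⟩
      z                                ∎
      where open ≡-Reasoning

  ·-injective : ∀ {c c′} → c < n → c′ < n → (∀ y → c · y ≡ c′ · y) → c ≡ c′
  ·-injective {c} {c′} c<n c′<n eq with ≤-total c c′
  ... | inj₁ c≤c′ = ≤-·-injective c≤c′ c′<n eq
  ... | inj₂ c′≤c = sym (≤-·-injective c′≤c c<n (sym ∘ eq))

-- Intertwining and the double coset

module Intertwining {n} .{{_ : NonZero n}} (σ : Permutation′ n) (order : HasOrder σ n)
                   (ξ : Permutation′ n) where
  open Powers σ
  open Periodic σ (proj₁ (proj₂ order))
  open Order σ order

  record Intertwines (k l : ℕ) : Set where
    constructor intertwining
    field commutes : ((σ ^ₚ k) ∘ₚ ξ) ≈ₚ (ξ ∘ₚ (σ ^ₚ l))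
  open Intertwines

  infix 25 σ^_ξσ^_
  σ^_ξσ^_ : ℕ → ℕ → Permutation′ n
  σ^ a ξσ^ c = ((σ ^ₚ a) ∘ₚ ξ) ∘ₚ (σ ^ₚ c)

  intertwines-+ : ∀ {a b c e} → Intertwines a b → Intertwines c e → Intertwines (a + c) (b + e)
  intertwines-+ {a} {b} {c} {e} a⇄b c⇄e = intertwining λ i → begin
    ξ ⟨$⟩ʳ ((a + c) · i)     ≡⟨ cong (ξ ⟨$⟩ʳ_) (·-+ a c i) ⟩
    ξ ⟨$⟩ʳ (c · a · i)       ≡⟨ commutes c⇄e (a · i) ⟩
    e · (ξ ⟨$⟩ʳ (a · i))     ≡⟨ cong (e ·_) (commutes a⇄b i) ⟩
    e · b · (ξ ⟨$⟩ʳ i)       ≡⟨ ·-+ b e (ξ ⟨$⟩ʳ i) ⟨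
    (b + e) · (ξ ⟨$⟩ʳ i)     ∎
    where open ≡-Reasoning

  intertwines-* : ∀ {a b} → Intertwines a b → ∀ q → Intertwines (q * a) (q * b)
  intertwines-* a⇄b zero    = intertwining λ _ → refl
  intertwines-* a⇄b (suc q) = intertwines-+ a⇄b (intertwines-* a⇄b q)

  intertwines-%ʳ : ∀ {k l} → Intertwines k l → Intertwines k (l % n)
  intertwines-%ʳ {l = l} k⇄l = intertwining λ i → trans (commutes k⇄l i) (·-% l _)

  intertwines-∣ʳ : ∀ {k l} → Intertwines k l → n ∣ k → n ∣ l
  intertwines-∣ʳ {k} {l} k⇄l n∣k = ·-id⇒∣ λ y → begin
    l · y                          ≡⟨ cong (l ·_) (inverseʳ ξ) ⟨
    l · (ξ ⟨$⟩ʳ (ξ ⟨$⟩ˡ y))        ≡⟨ commutes k⇄l _ ⟨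
    ξ ⟨$⟩ʳ (k · (ξ ⟨$⟩ˡ y))        ≡⟨ cong (ξ ⟨$⟩ʳ_) (∣⇒·-id n∣k _) ⟩
    ξ ⟨$⟩ʳ (ξ ⟨$⟩ˡ y)              ≡⟨ inverseʳ ξ ⟩
    y                              ∎
    where open ≡-Reasoning

  intertwines-∣ˡ : ∀ {k l} → Intertwines k l → n ∣ l → n ∣ k
  intertwines-∣ˡ {k} k⇄l n∣l = ·-id⇒∣ λ i → begin
    k · i                          ≡⟨ inverseˡ ξ ⟨
    ξ ⟨$⟩ˡ (ξ ⟨$⟩ʳ (k · i))        ≡⟨ cong (ξ ⟨$⟩ˡ_) (trans (commutes k⇄l i) (∣⇒·-id n∣l _)) ⟩
    ξ ⟨$⟩ˡ (ξ ⟨$⟩ʳ i)              ≡⟨ inverseˡ ξ ⟩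
    i                              ∎
    where open ≡-Reasoning

  coset∈class : ∀ a c → InClass σ ξ (σ^ a ξσ^ c)
  coset∈class a c = a , negate c , λ i → sym (·-negateˡ c _)

  class⊆cosets : ∀ {β k l} → ((σ ^ₚ k) ∘ₚ ξ) ≈ₚ (β ∘ₚ (σ ^ₚ l)) → σ^ k ξσ^ negate l ≈ₚ β
  class⊆cosets {l = l} eq i = trans (cong (negate l ·_) (eq i)) (·-negateˡ l _)

  coset-%ʳ : ∀ a c → σ^ a ξσ^ c ≈ₚ σ^ a ξσ^ (c % n)
  coset-%ʳ a c i = ·-% c _

  coset-shift : ∀ {d l} → Intertwines d l → ∀ a q c → σ^ (a + q * d) ξσ^ c ≈ₚ σ^ a ξσ^ (q * l + c)
  coset-shift {d} {l} d⇄l a q c i = begin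
    c · (ξ ⟨$⟩ʳ ((a + q * d) · i))   ≡⟨ cong (λ x → c · (ξ ⟨$⟩ʳ x)) (·-+ a (q * d) i) ⟩
    c · (ξ ⟨$⟩ʳ ((q * d) · a · i))   ≡⟨ cong (c ·_) (commutes (intertwines-* d⇄l q) (a · i)) ⟩
    c · (q * l) · (ξ ⟨$⟩ʳ (a · i))   ≡⟨ ·-+ (q * l) c _ ⟨
    (q * l + c) · (ξ ⟨$⟩ʳ (a · i))   ∎
    where open ≡-Reasoning

  coset-cancel : ∀ a a′ c c′ → σ^ a ξσ^ c ≈ₚ σ^ a′ ξσ^ c′ → a ≤ a′ →
                 Intertwines (a′ ∸ a) (c + negate c′)
  coset-cancel a a′ c c′ eq a≤a′ = intertwining λ j →
    subst (λ x → ξ ⟨$⟩ʳ ((a′ ∸ a) · x) ≡ (c + negate c′) · (ξ ⟨$⟩ʳ x)) (·-negateʳ a j)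
          (on-image (negate a · j))
    where
    open ≡-Reasoning
    on-image : ∀ i → ξ ⟨$⟩ʳ ((a′ ∸ a) · a · i) ≡ (c + negate c′) · (ξ ⟨$⟩ʳ (a · i))
    on-image i = begin
      ξ ⟨$⟩ʳ ((a′ ∸ a) · a · i)              ≡⟨ cong (ξ ⟨$⟩ʳ_) (·-+ a (a′ ∸ a) i) ⟨
      ξ ⟨$⟩ʳ ((a + (a′ ∸ a)) · i)            ≡⟨ cong (λ x → ξ ⟨$⟩ʳ (x · i)) (m+[n∸m]≡n a≤a′) ⟩
      ξ ⟨$⟩ʳ (a′ · i)                        ≡⟨ ·-negateˡ c′ _ ⟨
      negate c′ · c′ · (ξ ⟨$⟩ʳ (a′ · i))     ≡⟨ cong (negate c′ ·_) (eq i) ⟨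
      negate c′ · c · (ξ ⟨$⟩ʳ (a · i))       ≡⟨ ·-+ c (negate c′) _ ⟨
      (c + negate c′) · (ξ ⟨$⟩ʳ (a · i))     ∎

  coset-cancelʳ : ∀ a c c′ → σ^ a ξσ^ c ≈ₚ σ^ a ξσ^ c′ → ∀ y → c · y ≡ c′ · y
  coset-cancelʳ a c c′ eq y = subst (λ z → c · z ≡ c′ · z) onto (eq (negate a · (ξ ⟨$⟩ˡ y)))
    where
    onto : ξ ⟨$⟩ʳ (a · negate a · (ξ ⟨$⟩ˡ y)) ≡ y
    onto = trans (cong (ξ ⟨$⟩ʳ_) (·-negateʳ a _)) (inverseʳ ξ)

  record LeastShift : Set where
    field
      d     : ℕ
      l     : ℕ
      d>0   : 0 < d
      l<n   : l < n
      d⇄l   : Intertwines d l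
      least : ∀ {j k} → j < d → Intertwines j k → j ≡ 0

  n⇄0 : Intertwines n 0
  n⇄0 = intertwining λ i → cong (ξ ⟨$⟩ʳ_) (∣⇒·-id ∣-refl i)

  PositiveShift : ℕ → Set
  PositiveShift d = 0 < d × ∃[ l ] Intertwines d (toℕ {n} l)

  positiveShift? : ∀ d → Dec (PositiveShift d)
  positiveShift? d = (0 <? d) ×-dec any? λ l →
    map′ intertwining commutes (all? λ i → ξ ⟨$⟩ʳ (d · i) ≟ᶠ toℕ l · (ξ ⟨$⟩ʳ i))

  intertwines-Fin : ∀ {k l} → Intertwines k l → ∃[ l′ ] Intertwines k (toℕ {n} l′)
  intertwines-Fin {k} {l} k⇄l =
    fromℕ< (m%n<n l n) , subst (Intertwines k) (sym (toℕ-fromℕ< (m%n<n l n))) (intertwines-%ʳ k⇄l)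

  -- Opaque, so that type checking never unfolds the search.
  opaque
    least-shift : LeastShift
    least-shift with least-witness positiveShift? (>-nonZero⁻¹ n , intertwines-Fin n⇄0)
    ... | d , (d>0 , l , d⇄l) , below = record
      { d = d ; l = toℕ l ; d>0 = d>0 ; l<n = toℕ<n l ; d⇄l = d⇄l ; least = least }
      where
      least : ∀ {j k} → j < d → Intertwines j k → j ≡ 0
      least {zero}  _   _   = refl
      least {suc j} j<d j⇄k = contradiction (z<s , intertwines-Fin j⇄k) (below j<d)

  module LeastShiftProperties (ls : LeastShift) where
    open LeastShift ls public

    instance
      d≢0 : NonZero d
      d≢0 = >-nonZero d>0

    coset-reduce : ∀ k c → σ^ k ξσ^ c ≈ₚ σ^ (k % d) ξσ^ (k / d * l + c)
    coset-reduce k c i = trans (cong (λ x → c · (ξ ⟨$⟩ʳ (x · i))) (m≡m%n+[m/n]*n k d))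
                               (coset-shift d⇄l (k % d) (k / d) c i)

    shift-unique : ∀ {a a′ c c′} → σ^ a ξσ^ c ≈ₚ σ^ a′ ξσ^ c′ → a ≤ a′ → a′ < d → a ≡ a′
    shift-unique {a} {a′} {c} {c′} eq a≤a′ a′<d =
      ≤-antisym a≤a′ (m∸n≡0⇒m≤n (least (≤-<-trans (m∸n≤m a′ a) a′<d) (coset-cancel a a′ c c′ eq a≤a′)))

    coset-injective : ∀ {a a′ c c′} → a < d → a′ < d → c < n → c′ < n →
                      σ^ a ξσ^ c ≈ₚ σ^ a′ ξσ^ c′ → a ≡ a′ × c ≡ c′
    coset-injective {a} {a′} {c} {c′} a<d a′<d c<n c′<n eq =
      a≡a′ , ·-injective c<n c′<n
               (coset-cancelʳ a c c′ (subst (λ x → σ^ a ξσ^ c ≈ₚ σ^ x ξσ^ c′) (sym a≡a′) eq))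
      where
      a≡a′ : a ≡ a′
      a≡a′ with ≤-total a a′
      ... | inj₁ a≤a′ = shift-unique {a} {a′} {c} {c′} eq a≤a′ a′<d
      ... | inj₂ a′≤a = sym (shift-unique {a′} {a} {c′} {c} (sym ∘ eq) a′≤a a<d)

    intertwines⇒d∣ : ∀ {k m} → Intertwines k m → d ∣ k
    intertwines⇒d∣ {k} {m} k⇄m =
      m%n≡0⇒n∣m k d (least (m%n<n k d) (coset-cancel 0 (k % d) m (k / d * l + 0) eq z≤n))
      where
      eq : σ^ 0 ξσ^ m ≈ₚ σ^ (k % d) ξσ^ (k / d * l + 0)
      eq i = trans (sym (commutes k⇄m i)) (coset-reduce k 0 i)

    d∣n : d ∣ n
    d∣n = intertwines⇒d∣ n⇄0

    class-card : HasCard (InClass σ ξ) (d * n)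
    class-card = hasCard-× coset injective surjective
      where
      coset : Fin d × Fin n → Σ (Permutation′ n) (InClass σ ξ)
      coset (a , c) = σ^ toℕ a ξσ^ toℕ c , coset∈class (toℕ a) (toℕ c)

      injective : ∀ p q → proj₁ (coset p) ≈ₚ proj₁ (coset q) → p ≡ q
      injective (a , c) (a′ , c′) eq with coset-injective (toℕ<n a) (toℕ<n a′) (toℕ<n c) (toℕ<n c′) eq
      ... | a≡a′ , c≡c′ = cong₂ _,_ (toℕ-injective a≡a′) (toℕ-injective c≡c′)

      surjective : ∀ β → InClass σ ξ β → ∃[ p ] (proj₁ (coset p) ≈ₚ β)
      surjective β (k , m , eq) = (fromℕ< (m%n<n k d) , fromℕ< (m%n<n c n)) , represents
        where
        c = k / d * l + negate m
        represents : σ^ toℕ (fromℕ< (m%n<n k d)) ξσ^ toℕ (fromℕ< (m%n<n c n)) ≈ₚ β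
        represents i rewrite toℕ-fromℕ< (m%n<n k d) | toℕ-fromℕ< (m%n<n c n) =
          trans (sym (coset-%ʳ (k % d) c i))
                (trans (sym (coset-reduce k (negate m) i)) (class⊆cosets {β} {k} {m} eq i))

    ann⊆ : ∀ j → n ∣ j * d → n ∣ j * l
    ann⊆ j = intertwines-∣ʳ (intertwines-* d⇄l j)

    ann⊇ : ∀ j → n ∣ j * l → n ∣ j * d
    ann⊇ j = intertwines-∣ˡ (intertwines-* d⇄l j)

lemma2 : (n : ℕ) → 1 ≤ n → (σ : Permutation′ n) → HasOrder σ n → (ξ : Permutation′ n) →
    (HasCard (InClass σ ξ) (n * n))
    ⊎ (∃[ k ] ∃[ l ] (((σ ^ₚ k) ∘ₚ ξ) ≈ₚ (ξ ∘ₚ (σ ^ₚ l))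
        × 1 ≤ k × k ≤ l × l < n × k ∣ n × HasCard (InClass σ ξ) (k * n) × k ∣ l
        × (∃[ s ] (1 ≤ s × s < n × gcd s n ≡ 1 × l ≡ odot n s k))))
lemma2 zero    () _ _ _
lemma2 (suc n′) _ σ order ξ = [ proper , whole ]′ (m≤n⇒m<n∨m≡n (∣⇒≤ d∣n))
  where
  open Intertwining σ order ξ
  open LeastShiftProperties least-shift

  proper : d < suc n′ → _
  proper d<n = inj₂ (d , l , Intertwines.commutes d⇄l , d>0 , d≤l , l<n , d∣n , class-card , d∣l ,
                     unit-multiple)
    where open SameAnnihilator d∣n d>0 d<n l<n ann⊆ ann⊇

  whole : d ≡ suc n′ → _
  whole d≡n = inj₁ (subst (λ k → HasCard (InClass σ ξ) (k * suc n′)) d≡n class-card)
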